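{- For every $n\ge1$, the labeling $\lambda_\bullet$ is an ER-labeling of $\Pi_n^\bullet$; that is, every closed interval of $\Pi_n^\bullet$ has a unique maximal chain that is increasing with respect to $\lambda_\bullet$.
   Context: A pointed set is a pair $(A,p)$, written $A^p$, with $A$ nonempty finite and $p\in A$. A pointed partition of $[n]$ is a collection of pointed sets whose underlying sets form a set partition of $[n]$. In $\Pi_n^\bullet$, $\pi\lessdot\pi'$ exactly when $\pi'$ is obtained from $\pi$ by replacing two blocks $A^p,B^q$ (with $\min A<\min B$) by $(A\cup B)^p$ (a $1$-merge) or $(A\cup B)^q$ (a $0$-merge), other blocks unchanged. The labeling $\lambda_\bullet$ assigns to a $u$-merge the label $(\min A,\min B)^u$, valued in the poset $\Lambda_n^\bullet$ whose elements are $(a,b)^u$ with $1\le a<b\le n$, $u\in\{0,1\}$, ordered as the ordinal sum $A_1\oplus C_1\oplus A_2\oplus C_2\oplus\cdots\oplus A_{n-1}\oplus C_{n-1}$, where $A_a$ is the antichain $\{(a,b)^0:a<b\le n\}$ and $C_a$ is the chain $\{(a,b)^1: a<b\le n\}$ with $(a,b)^1<(a,c)^1$ iff $b<c$. A saturated chain $x_0\lessdot\cdots\lessdot x_m$ is increasing if consecutive labels satisfy $\lambda(x_{i-1}\lessdot x_i)<\lambda(x_i\lessdot x_{i+1})$ in $\Lambda_n^\bullet$. -}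

module Defs where

open import Data.Nat using (ℕ)
open import Data.Fin using (Fin; _<_; _≤_; _≟_)
open import Data.Vec using (Vec; lookup; tabulate)
open import Data.Bool using (Bool; true; false; if_then_else_; _∨_)
open import Data.List using (List; []; _∷_)
open import Data.Product using (Σ; _×_; _,_; ∃-syntax)
open import Data.Sum using (_⊎_)
open import Data.Unit using (⊤)
open import Relation.Nullary using (¬_)
open import Relation.Nullary.Decidable using (⌊_⌋)
open import Relation.Binary.PropositionalEquality using (_≡_)

-- A pointed partition of [n] = {0,…,n-1} (0-indexed) is encoded by the
-- vector π sending each element to the point of its block.  The blocks are the
-- fibres of π and the point of the block A is the unique p ∈ A with π p ≡ p.
-- A vector encodes a pointed partition iff it is idempotent.
PPVec : ℕ → Set
PPVec n = Vec (Fin n) n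

IsPointedPartition : ∀ {n} → PPVec n → Set
IsPointedPartition π = ∀ i → lookup π (lookup π i) ≡ lookup π i

IsPoint : ∀ {n} → PPVec n → Fin n → Set
IsPoint π p = lookup π p ≡ p

IsMinOfBlock : ∀ {n} → PPVec n → Fin n → Fin n → Set
IsMinOfBlock π p a = (lookup π a ≡ p) × (∀ i → lookup π i ≡ p → a ≤ i)

merge : ∀ {n} → PPVec n → Fin n → Fin n → Fin n → PPVec n
merge π p q r = tabulate λ i →
  if ⌊ lookup π i ≟ p ⌋ ∨ ⌊ lookup π i ≟ q ⌋ then r else lookup π i

-- Labels (a , b , u) stand for (a,b)^u ; u = true is a 1-merge, false a 0-merge.
Label : ℕ → Set
Label n = Fin n × Fin n × Bool

Cover : ∀ {n} → PPVec n → PPVec n → Label n → Set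
Cover {n} π π' (a , b , u) =
  IsPointedPartition π ×
  Σ (Fin n) λ p → Σ (Fin n) λ q →
    IsPoint π p × IsPoint π q × ¬ (p ≡ q) ×
    IsMinOfBlock π p a × IsMinOfBlock π q b × (a < b) ×
    (π' ≡ merge π p q (if u then p else q))

-- Order of Λ_n^• : ordinal sum A_1 ⊕ C_1 ⊕ A_2 ⊕ C_2 ⊕ ⋯ where A_a is the antichain
-- {(a,b)^0} and C_a is the chain {(a,b)^1} ordered by b.
_<Λ_ : ∀ {n} → Label n → Label n → Set
(a , b , u) <Λ (a' , b' , u') =
  (a < a') ⊎
  ((a ≡ a') × (((u ≡ false) × (u' ≡ true)) ⊎ ((u ≡ true) × (u' ≡ true) × (b < b'))))

-- A saturated chain x = x₀ ⋖ x₁ ⋖ ⋯ ⋖ x_m = y, given as the list of steps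
-- (λ(x_{i-1} ⋖ x_i) , x_i).
SatChain : ∀ {n} → PPVec n → List (Label n × PPVec n) → PPVec n → Set
SatChain x [] y = x ≡ y
SatChain x ((l , z) ∷ rest) y = Cover x z l × SatChain z rest y

Increasing : ∀ {n} → List (Label n × PPVec n) → Set
Increasing [] = ⊤
Increasing ((l , _) ∷ []) = ⊤
Increasing ((l , _) ∷ (l' , z) ∷ rest) = (l <Λ l') × Increasing ((l' , z) ∷ rest)

_≼_ : ∀ {n} → PPVec n → PPVec n → Set
x ≼ y = ∃[ steps ] SatChain x steps y

-- The increasing chain from x to y is built greedily.  Let a be the least minimum of
-- an x-block that is not yet a whole y-block.  If y keeps the point of that block, the
-- first step is the 1-merge with the block of least minimum b among the x-blocks it
-- meets in y; otherwise it is the 0-merge with the block B holding its point in y,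
-- b = min B.  Every increasing chain starts with this step: first coordinates of its
-- labels never decrease, so no block with minimum below a is ever touched, and after
-- the label (a,b)^u every later merge into the block of a is a 1-merge with a partner
-- above b.  Conversely the greedy step stays below y, consecutive greedy labels
-- increase, and each step removes a point, so the greedy chain reaches y.
module Submission where

open import Defs
open import Data.Nat using (ℕ; _≤_; z≤n; s≤s)
import Data.Nat.Properties as ℕ
open import Data.Fin using (Fin; _≟_) renaming (_≤_ to _≤ᶠ_; _<_ to _<ᶠ_)
open import Data.Fin.Properties using (all?; any?) renaming (_≤?_ to _≤ᶠ?_)
import Data.Fin.Properties as Fin
open import Data.Fin.Subset using (Subset; _∈_; _⊂_)
open import Data.Fin.Subset.Induction using (⊂-wellFounded)
open import Data.Vec using (lookup; tabulate)
open import Data.Vec.Properties using (lookup∘tabulate; tabulate∘lookup; tabulate-cong; lookup⇒[]=; []=⇒lookup)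
open import Data.Bool using (Bool; true; false; not; if_then_else_; _∨_)
open import Data.List using (List; []; _∷_)
open import Data.List.Relation.Unary.All as All using (All; []; _∷_)
open import Data.Product using (Σ; _×_; _,_; ∃; ∃-syntax; proj₁; proj₂)
open import Data.Sum using (_⊎_; inj₁; inj₂; [_,_]′)
import Data.Sum as Sum
open import Data.Unit using (⊤; tt)
open import Data.Empty using (⊥-elim)
open import Function using (_∘_)
open import Induction.WellFounded using (Acc; acc)
open import Relation.Nullary using (¬_; Dec; does; yes; no; ¬?)
open import Relation.Nullary.Decidable using (⌊_⌋; map′; _×-dec_; _→-dec_; dec-true)
open import Relation.Binary.PropositionalEquality using (_≡_; _≢_; refl; sym; trans; cong; subst)

infixl 9 _!_
_!_ : ∀ {n} → PPVec n → Fin n → Fin n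
x ! i = lookup x i

lookup-ext : ∀ {n} {x y : PPVec n} → (∀ i → x ! i ≡ y ! i) → x ≡ y
lookup-ext {x = x} {y} x≗y = trans (sym (tabulate∘lookup x)) (trans (tabulate-cong x≗y) (tabulate∘lookup y))

IsBlockMin : ∀ {n} → PPVec n → Fin n → Set
IsBlockMin x c = ∀ j → x ! j ≡ x ! c → c ≤ᶠ j

isBlockMin? : ∀ {n} (x : PPVec n) c → Dec (IsBlockMin x c)
isBlockMin? x c = all? λ j → (x ! j ≟ x ! c) →-dec (c ≤ᶠ? j)

least : ∀ {n} {P : Fin n → Set} → (∀ i → Dec (P i)) → ∃ P → ∃[ m ] P m × (∀ {j} → P j → m ≤ᶠ j)
least P? (Fin.zero , p) = Fin.zero , p , λ _ → z≤n
least {P = P} P? (Fin.suc i , p) with P? Fin.zero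
... | yes p₀ = Fin.zero , p₀ , λ _ → z≤n
... | no ¬p₀ with least {P = P ∘ Fin.suc} (P? ∘ Fin.suc) (i , p)
...   | m , pm , below =
  Fin.suc m , pm , λ { {Fin.zero} p₀ → ⊥-elim (¬p₀ p₀) ; {Fin.suc j} pj → s≤s (below pj) }

block-min : ∀ {n} (x : PPVec n) i → ∃[ m ] x ! m ≡ x ! i × IsBlockMin x m
block-min x i with least (λ j → x ! j ≟ x ! i) (i , refl)
... | m , xm≡xi , below = m , xm≡xi , λ j xj≡xm → below (trans xj≡xm xm≡xi)

module _ {n} (π : PPVec n) (p q r : Fin n) where

  private
    lookup-merge : ∀ i → merge π p q r ! i ≡ (if ⌊ π ! i ≟ p ⌋ ∨ ⌊ π ! i ≟ q ⌋ then r else π ! i)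
    lookup-merge = lookup∘tabulate _

  lookup-merge-inside : ∀ i → π ! i ≡ p ⊎ π ! i ≡ q → merge π p q r ! i ≡ r
  lookup-merge-inside i (inj₁ e) rewrite lookup-merge i | e with p ≟ p
  ... | yes _ = refl
  ... | no p≢p = ⊥-elim (p≢p refl)
  lookup-merge-inside i (inj₂ e) rewrite lookup-merge i | e with q ≟ p | q ≟ q
  ... | yes _ | _ = refl
  ... | no _ | yes _ = refl
  ... | no _ | no q≢q = ⊥-elim (q≢q refl)

  lookup-merge-outside : ∀ i → π ! i ≢ p → π ! i ≢ q → merge π p q r ! i ≡ π ! i
  lookup-merge-outside i ne₁ ne₂ rewrite lookup-merge i with π ! i ≟ p | π ! i ≟ q
  ... | yes e | _ = ⊥-elim (ne₁ e)
  ... | no _ | yes e = ⊥-elim (ne₂ e)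
  ... | no _ | no _ = refl

  lookup-merge-cong : ∀ {i j} → π ! i ≡ π ! j → merge π p q r ! i ≡ merge π p q r ! j
  lookup-merge-cong {i} {j} e = trans (lookup-merge i)
    (trans (cong (λ t → if ⌊ t ≟ p ⌋ ∨ ⌊ t ≟ q ⌋ then r else t) e) (sym (lookup-merge j)))

Merged : ∀ {n} → PPVec n → Fin n → Fin n → Fin n → Set
Merged x a b i = x ! i ≡ x ! a ⊎ x ! i ≡ x ! b

keptPoint : ∀ {n} → PPVec n → Fin n → Fin n → Bool → Fin n
keptPoint x a b u = if u then x ! a else x ! b

module _ {n} (x : PPVec n) (a b : Fin n) where

  keptPoint-cases : ∀ u → keptPoint x a b u ≡ x ! a ⊎ keptPoint x a b u ≡ x ! b
  keptPoint-cases true = inj₁ refl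
  keptPoint-cases false = inj₂ refl

  keptPoint-isPoint : IsPointedPartition x → ∀ u → IsPoint x (keptPoint x a b u)
  keptPoint-isPoint pp true = pp a
  keptPoint-isPoint pp false = pp b

  keptPoint-merged : IsPointedPartition x → ∀ u → Merged x a b (keptPoint x a b u)
  keptPoint-merged pp true = inj₁ (pp a)
  keptPoint-merged pp false = inj₂ (pp b)

  keptPoint-≢-not : x ! a ≢ x ! b → ∀ u → keptPoint x a b u ≢ keptPoint x a b (not u)
  keptPoint-≢-not ne true = ne
  keptPoint-≢-not ne false = ne ∘ sym

record Merge {n} (x z : PPVec n) (a b : Fin n) (u : Bool) : Set where
  field
    pointed : IsPointedPartition x
    distinct : x ! a ≢ x ! b
    a-min : IsBlockMin x a
    b-min : IsBlockMin x b
    a<b : a <ᶠ b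
    result : z ≡ merge x (x ! a) (x ! b) (keptPoint x a b u)

cover⇒merge : ∀ {n} {x z : PPVec n} {a b u} → Cover x z (a , b , u) → Merge x z a b u
cover⇒merge (pp , _ , _ , _ , _ , ne , (refl , a-min) , (refl , b-min) , a<b , refl) =
  record { pointed = pp ; distinct = ne ; a-min = a-min ; b-min = b-min ; a<b = a<b ; result = refl }

merge⇒cover : ∀ {n} {x z : PPVec n} {a b u} → Merge x z a b u → Cover x z (a , b , u)
merge⇒cover {x = x} {a = a} {b} m =
  pointed , x ! a , x ! b , pointed a , pointed b , distinct , (refl , a-min) , (refl , b-min) , a<b , result
  where open Merge m

module MergeProperties {n} {x z : PPVec n} {a b : Fin n} {u : Bool} (m : Merge x z a b u) where
  open Merge m

  kept dropped : Fin n
  kept = keptPoint x a b u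
  dropped = keptPoint x a b (not u)

  data Side (i : Fin n) : Set where
    inside : Merged x a b i → Side i
    outside : x ! i ≢ x ! a → x ! i ≢ x ! b → Side i

  side : ∀ i → Side i
  side i with x ! i ≟ x ! a | x ! i ≟ x ! b
  ... | yes e | _ = inside (inj₁ e)
  ... | no _ | yes e = inside (inj₂ e)
  ... | no ne₁ | no ne₂ = outside ne₁ ne₂

  z-inside : ∀ {i} → Merged x a b i → z ! i ≡ kept
  z-inside {i} mi = trans (cong (_! i) result) (lookup-merge-inside x _ _ _ i mi)

  z-outside : ∀ {i} → x ! i ≢ x ! a → x ! i ≢ x ! b → z ! i ≡ x ! i
  z-outside {i} ne₁ ne₂ = trans (cong (_! i) result) (lookup-merge-outside x _ _ _ i ne₁ ne₂)

  z-a : z ! a ≡ kept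
  z-a = z-inside (inj₁ refl)

  z-b : z ! b ≡ kept
  z-b = z-inside (inj₂ refl)

  outside-≢-kept : ∀ {i} → x ! i ≢ x ! a → x ! i ≢ x ! b → x ! i ≢ kept
  outside-≢-kept ne₁ ne₂ e = [ ne₁ , ne₂ ]′ (Sum.map (trans e) (trans e) (keptPoint-cases x a b u))

  coarsens : ∀ {i j} → x ! i ≡ x ! j → z ! i ≡ z ! j
  coarsens {i} {j} e = subst (λ v → v ! i ≡ v ! j) (sym result) (lookup-merge-cong x _ _ _ e)

  coarsened : ∀ {i j} → z ! i ≡ z ! j → x ! i ≡ x ! j ⊎ Merged x a b i × Merged x a b j
  coarsened {i} {j} e with side i | side j
  ... | inside mi | inside mj = inj₂ (mi , mj)
  ... | inside mi | outside ne₁ ne₂ =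
    ⊥-elim (outside-≢-kept ne₁ ne₂ (trans (sym (z-outside ne₁ ne₂)) (trans (sym e) (z-inside mi))))
  ... | outside ne₁ ne₂ | inside mj =
    ⊥-elim (outside-≢-kept ne₁ ne₂ (trans (sym (z-outside ne₁ ne₂)) (trans e (z-inside mj))))
  ... | outside ne₁ ne₂ | outside ne₁′ ne₂′ =
    inj₁ (trans (sym (z-outside ne₁ ne₂)) (trans e (z-outside ne₁′ ne₂′)))

  block-unchanged : ∀ {c} → x ! c ≢ x ! a → x ! c ≢ x ! b → ∀ j → z ! j ≡ z ! c → x ! j ≡ x ! c
  block-unchanged ne₁ ne₂ j e with coarsened e
  ... | inj₁ xj≡xc = xj≡xc
  ... | inj₂ (_ , mc) = ⊥-elim ([ ne₁ , ne₂ ]′ mc)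

  merged-block : ∀ {j} → z ! j ≡ z ! a → Merged x a b j
  merged-block e with coarsened e
  ... | inj₁ xj≡xa = inj₁ xj≡xa
  ... | inj₂ (mj , _) = mj

  a-min-after : IsBlockMin z a
  a-min-after j e with merged-block e
  ... | inj₁ xj≡xa = a-min j xj≡xa
  ... | inj₂ xj≡xb = ℕ.<⇒≤ (ℕ.<-≤-trans a<b (b-min j xj≡xb))

  kept-point : IsPoint x kept
  kept-point = keptPoint-isPoint x a b pointed u

  pointed-after : IsPointedPartition z
  pointed-after i with side i
  ... | inside mi =
    trans (cong (z !_) (z-inside mi)) (trans (z-inside (keptPoint-merged x a b pointed u)) (sym (z-inside mi)))
  ... | outside ne₁ ne₂ = trans (cong (z !_) (z-outside ne₁ ne₂)) (coarsens (pointed i))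

  point-before : ∀ {t} → IsPoint z t → IsPoint x t
  point-before {t} e with side t
  ... | inside mt = subst (IsPoint x) (trans (sym (z-inside mt)) e) kept-point
  ... | outside ne₁ ne₂ = trans (sym (z-outside ne₁ ne₂)) e

  dropped-point : IsPoint x dropped
  dropped-point = keptPoint-isPoint x a b pointed (not u)

  dropped-not-point : ¬ IsPoint z dropped
  dropped-not-point e =
    keptPoint-≢-not x a b distinct u (trans (sym (z-inside (keptPoint-merged x a b pointed (not u)))) e)

points : ∀ {n} → PPVec n → Subset n
points x = tabulate λ i → does (x ! i ≟ i)

∈-points⁺ : ∀ {n} (x : PPVec n) {i} → IsPoint x i → i ∈ points x
∈-points⁺ x {i} e = lookup⇒[]= i (points x) (trans (lookup∘tabulate _ i) (dec-true (x ! i ≟ i) e))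

∈-points⁻ : ∀ {n} (x : PPVec n) {i} → i ∈ points x → IsPoint x i
∈-points⁻ x {i} i∈ with x ! i ≟ i | trans (sym (lookup∘tabulate _ i)) ([]=⇒lookup i∈)
... | yes e | _ = e
... | no _ | ()

points-shrink : ∀ {n} {x z : PPVec n} {a b u} → Merge x z a b u → points z ⊂ points x
points-shrink {x = x} {z} m =
  (λ i∈ → ∈-points⁺ x (point-before (∈-points⁻ z i∈))) ,
  dropped , ∈-points⁺ x dropped-point , dropped-not-point ∘ ∈-points⁻ z
  where open MergeProperties m

<Λ-trans : ∀ {n} {l l′ l″ : Label n} → l <Λ l′ → l′ <Λ l″ → l <Λ l″
<Λ-trans (inj₁ p) (inj₁ q) = inj₁ (ℕ.<-trans p q)
<Λ-trans (inj₁ p) (inj₂ (refl , _)) = inj₁ p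
<Λ-trans (inj₂ (refl , _)) (inj₁ q) = inj₁ q
<Λ-trans (inj₂ (refl , inj₁ (_ , refl))) (inj₂ (refl , inj₁ (() , _)))
<Λ-trans (inj₂ (refl , inj₁ (refl , refl))) (inj₂ (refl , inj₂ (_ , refl , _))) = inj₂ (refl , inj₁ (refl , refl))
<Λ-trans (inj₂ (refl , inj₂ (refl , refl , _))) (inj₂ (refl , inj₁ (() , _)))
<Λ-trans (inj₂ (refl , inj₂ (refl , refl , p))) (inj₂ (refl , inj₂ (_ , refl , q))) =
  inj₂ (refl , inj₂ (refl , refl , ℕ.<-trans p q))

<Λ⇒fst≤ : ∀ {n} {a a′ b b′ : Fin n} {u u′} → (a , b , u) <Λ (a′ , b′ , u′) → a ≤ᶠ a′
<Λ⇒fst≤ (inj₁ p) = ℕ.<⇒≤ p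
<Λ⇒fst≤ (inj₂ (refl , _)) = ℕ.≤-refl

<Λ-same-fst : ∀ {n} {a b b′ : Fin n} {u u′} → (a , b , u) <Λ (a , b′ , u′) → u′ ≡ true × (u ≡ true → b <ᶠ b′)
<Λ-same-fst (inj₁ a<a) = ⊥-elim (ℕ.<-irrefl refl a<a)
<Λ-same-fst (inj₂ (_ , inj₁ (refl , refl))) = refl , λ ()
<Λ-same-fst (inj₂ (_ , inj₂ (_ , refl , b<b′))) = refl , λ _ → b<b′

Steps : ℕ → Set
Steps n = List (Label n × PPVec n)

infixr 5 _◅_
data MergeChain {n} : PPVec n → Steps n → PPVec n → Set where
  ε : ∀ {x} → MergeChain x [] x
  _◅_ : ∀ {x z y a b u s} → Merge x z a b u → MergeChain z s y → MergeChain x (((a , b , u) , z) ∷ s) y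

satChain⇒mergeChain : ∀ {n} (x : PPVec n) s {y} → SatChain x s y → MergeChain x s y
satChain⇒mergeChain x [] refl = ε
satChain⇒mergeChain x (((a , b , u) , z) ∷ s) (cov , sc) =
  cover⇒merge {x = x} {z} {a} {b} {u} cov ◅ satChain⇒mergeChain z s sc

mergeChain⇒satChain : ∀ {n} {x y : PPVec n} {s} → MergeChain x s y → SatChain x s y
mergeChain⇒satChain ε = refl
mergeChain⇒satChain (m ◅ c) = merge⇒cover m , mergeChain⇒satChain c

increasing-tail : ∀ {n} {step} (s : Steps n) → Increasing (step ∷ s) → Increasing s
increasing-tail [] _ = tt
increasing-tail (_ ∷ _) (_ , inc) = inc

increasing⇒above-head : ∀ {n} {l : Label n} {z} (s : Steps n) →
                        Increasing ((l , z) ∷ s) → All ((l <Λ_) ∘ proj₁) s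
increasing⇒above-head [] _ = []
increasing⇒above-head (_ ∷ s) (l<l′ , inc) = l<l′ ∷ All.map (<Λ-trans l<l′) (increasing⇒above-head s inc)

chain-coarsens : ∀ {n} {w y : PPVec n} {s} → MergeChain w s y → ∀ {i j} → w ! i ≡ w ! j → y ! i ≡ y ! j
chain-coarsens ε e = e
chain-coarsens (m ◅ c) e = chain-coarsens c (MergeProperties.coarsens m e)

chain-point-before : ∀ {n} {w y : PPVec n} {s} → MergeChain w s y → ∀ {t} → IsPoint y t → IsPoint w t
chain-point-before ε e = e
chain-point-before (m ◅ c) e = MergeProperties.point-before m (chain-point-before c e)

nonempty-chain-≢ : ∀ {n} {x z y : PPVec n} {a b u s} → Merge x z a b u → MergeChain z s y → x ≢ y
nonempty-chain-≢ {a = a} {b} m c refl = distinct (chain-coarsens c (trans z-a (sym z-b)))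
  where
  open Merge m
  open MergeProperties m

block-untouched : ∀ {n} {w y : PPVec n} {c} {s : Steps n} → MergeChain w s y →
                  All (λ step → c <ᶠ proj₁ (proj₁ step)) s → ∀ j → y ! j ≡ y ! c → w ! j ≡ w ! c
block-untouched ε [] j e = e
block-untouched {w = w} {c = c} (_◅_ {a = a} {b} m rest) (c<a ∷ above) j e =
  block-unchanged c∉A c∉B j (block-untouched rest above j e)
  where
  open Merge m
  open MergeProperties m
  c∉A : w ! c ≢ w ! a
  c∉A wc≡wa = ℕ.<⇒≱ c<a (a-min c wc≡wa)
  c∉B : w ! c ≢ w ! b
  c∉B wc≡wb = ℕ.<⇒≱ (ℕ.<-trans c<a a<b) (b-min c wc≡wb)

-- Uniqueness

GrowsAbove : ∀ {n} → Fin n → Fin n → Bool → PPVec n → PPVec n → Set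
GrowsAbove a b u w w′ = ∀ j → w′ ! j ≡ w′ ! a → w ! j ≡ w ! a ⊎ (u ≡ true → b <ᶠ j)

growsAbove-trans : ∀ {n} {a b : Fin n} {u w w′ w″} →
                   GrowsAbove a b u w w′ → GrowsAbove a b u w′ w″ → GrowsAbove a b u w w″
growsAbove-trans g g′ j e with g′ j e
... | inj₁ e′ = g j e′
... | inj₂ b<j = inj₂ b<j

first-block-merge : ∀ {n} {w w′ : PPVec n} {a b d u} → Merge w w′ a d true → (u ≡ true → b <ᶠ d) →
                    w′ ! a ≡ w ! a × IsBlockMin w′ a × GrowsAbove a b u w w′
first-block-merge {w = w} {w′} {a} {b} {u = u} m b<d = z-a , a-min-after , grows
  where
  open Merge m
  open MergeProperties m
  grows : GrowsAbove a b u w w′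
  grows j e with merged-block e
  ... | inj₁ wj≡wa = inj₁ wj≡wa
  ... | inj₂ wj≡wd = inj₂ λ ut → ℕ.<-≤-trans (b<d ut) (b-min j wj≡wd)

first-block-step : ∀ {n} {w w′ : PPVec n} {a b c d u v} → Merge w w′ c d v → (a , b , u) <Λ (c , d , v) →
                   IsBlockMin w a → w′ ! a ≡ w ! a × IsBlockMin w′ a × GrowsAbove a b u w w′
first-block-step {a = a} {c = c} m l<l′ a-min-w with MergeProperties.side m a
... | MergeProperties.inside (inj₁ wa≡wc) with Fin.≤-antisym (Merge.a-min m a wa≡wc) (a-min-w c (sym wa≡wc))
...   | refl with <Λ-same-fst l<l′
...     | refl , b<d = first-block-merge m b<d
first-block-step m l<l′ _ | MergeProperties.inside (inj₂ wa≡wd) =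
  ⊥-elim (ℕ.<⇒≱ (ℕ.≤-<-trans (<Λ⇒fst≤ l<l′) (Merge.a<b m)) (Merge.b-min m _ wa≡wd))
first-block-step {w = w} {w′} {a} m _ a-min-w | MergeProperties.outside ne₁ ne₂ =
  z-outside ne₁ ne₂ , (λ j e → a-min-w j (unchanged j e)) , λ j e → inj₁ (unchanged j e)
  where
  open MergeProperties m
  unchanged : ∀ j → w′ ! j ≡ w′ ! a → w ! j ≡ w ! a
  unchanged = block-unchanged ne₁ ne₂

first-block-chain : ∀ {n} {w y : PPVec n} {a b u} {s : Steps n} → MergeChain w s y →
                    All (((a , b , u) <Λ_) ∘ proj₁) s → IsBlockMin w a →
                    y ! a ≡ w ! a × GrowsAbove a b u w y
first-block-chain ε [] _ = refl , λ _ e → inj₁ e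
first-block-chain {w = w} {y} (_◅_ {z = w′} m c) (l<l′ ∷ above) a-min-w with first-block-step m l<l′ a-min-w
... | w′a≡wa , a-min-w′ , grows with first-block-chain c above a-min-w′
...   | ya≡w′a , grows′ = trans ya≡w′a w′a≡wa , growsAbove-trans {w = w} {w′} {y} grows grows′

Joined : ∀ {n} → PPVec n → PPVec n → Fin n → Fin n → Set
Joined x y c j = y ! j ≡ y ! c × x ! j ≢ x ! c

joined? : ∀ {n} (x y : PPVec n) c j → Dec (Joined x y c j)
joined? x y c j = (y ! j ≟ y ! c) ×-dec ¬? (x ! j ≟ x ! c)

record Unfinished {n} (x y : PPVec n) (c : Fin n) : Set where
  constructor unfinished
  field
    is-block-min : IsBlockMin x c
    joiner : Fin n
    joined : Joined x y c joiner

unfinished? : ∀ {n} (x y : PPVec n) c → Dec (Unfinished x y c)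
unfinished? x y c = map′ (λ (c-min , j , jd) → unfinished c-min j jd)
                         (λ (unfinished c-min j jd) → c-min , j , jd)
                         (isBlockMin? x c ×-dec any? (joined? x y c))

-- The label (a,b)^u of the greedy first step from x to y described above.
record Canonical {n} (x y : PPVec n) (a b : Fin n) (u : Bool) : Set where
  field
    same-block : y ! a ≡ y ! b
    least-unfinished : ∀ {c} → Unfinished x y c → a ≤ᶠ c
    kept-point : keptPoint x a b u ≡ y ! a
    least-joined : u ≡ true → ∀ j → IsBlockMin x j → Joined x y a j → b ≤ᶠ j

canonical-joined : ∀ {n} {x y z : PPVec n} {a b u} → Merge x z a b u → Canonical x y a b u → Joined x y a b
canonical-joined m can = sym (Canonical.same-block can) , Merge.distinct m ∘ sym

canonical-unfinished : ∀ {n} {x y z : PPVec n} {a b u} → Merge x z a b u → Canonical x y a b u → Unfinished x y a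
canonical-unfinished m can = unfinished (Merge.a-min m) _ (canonical-joined m can)

unfinished-before : ∀ {n} {x y z : PPVec n} {a b u c} → Merge x z a b u → Unfinished z y c → Unfinished x y c
unfinished-before m (unfinished c-min j (yj≡yc , zj≢zc)) =
  unfinished (λ i e → c-min i (coarsens e)) j (yj≡yc , zj≢zc ∘ coarsens)
  where open MergeProperties m

increasing⇒canonical : ∀ {n} {x y z : PPVec n} {a b u} {s : Steps n} → Merge x z a b u →
                       MergeChain z s y → Increasing (((a , b , u) , z) ∷ s) → Canonical x y a b u
increasing⇒canonical {x = x} {y} {z} {a} {b} {u} {s} m sc inc = record
  { same-block = chain-coarsens sc (trans z-a (sym z-b))
  ; least-unfinished = λ (unfinished _ j (yj≡yc , xj≢xc)) →
      ℕ.≮⇒≥ λ c<a → xj≢xc (block-untouched (m ◅ sc) (c<a ∷ All.map (ℕ.<-≤-trans c<a ∘ <Λ⇒fst≤) above) j yj≡yc)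
  ; kept-point = sym (trans a-stable z-a)
  ; least-joined = least-joined
  }
  where
  open Merge m
  open MergeProperties m
  above : All (((a , b , u) <Λ_) ∘ proj₁) s
  above = increasing⇒above-head s inc
  a-stable : y ! a ≡ z ! a
  a-stable = proj₁ (first-block-chain sc above a-min-after)
  least-joined : u ≡ true → ∀ j → IsBlockMin x j → Joined x y a j → b ≤ᶠ j
  least-joined ut j _ (yj≡ya , xj≢xa) with proj₂ (first-block-chain sc above a-min-after) j yj≡ya
  ... | inj₂ b<j = ℕ.<⇒≤ (b<j ut)
  ... | inj₁ zj≡za with merged-block zj≡za
  ...   | inj₁ xj≡xa = ⊥-elim (xj≢xa xj≡xa)
  ...   | inj₂ xj≡xb = b-min j xj≡xb

canonical-partner-unique : ∀ {n} {x y z z′ : PPVec n} {a b b′ u u′} → Merge x z a b u → Merge x z′ a b′ u′ →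
                           Canonical x y a b u → Canonical x y a b′ u′ → (b , u) ≡ (b′ , u′)
canonical-partner-unique {u = true} {true} m m′ can can′ =
  cong (_, true) (Fin.≤-antisym (least-joined can refl _ (Merge.b-min m′) (canonical-joined m′ can′))
                                (least-joined can′ refl _ (Merge.b-min m) (canonical-joined m can)))
  where open Canonical
canonical-partner-unique {x = x} {b = b} {b′} {false} {false} m m′ can can′ =
  cong (_, false) (Fin.≤-antisym (Merge.b-min m _ xb′≡xb) (Merge.b-min m′ _ (sym xb′≡xb)))
  where
  xb′≡xb : x ! b′ ≡ x ! b
  xb′≡xb = trans (Canonical.kept-point can′) (sym (Canonical.kept-point can))
canonical-partner-unique {u = true} {false} _ m′ can can′ =
  ⊥-elim (Merge.distinct m′ (trans (Canonical.kept-point can) (sym (Canonical.kept-point can′))))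
canonical-partner-unique {u = false} {true} m _ can can′ =
  ⊥-elim (Merge.distinct m (trans (Canonical.kept-point can′) (sym (Canonical.kept-point can))))

canonical-unique : ∀ {n} {x y z z′ : PPVec n} {a a′ b b′ u u′} → Merge x z a b u → Merge x z′ a′ b′ u′ →
                   Canonical x y a b u → Canonical x y a′ b′ u′ → (a , b , u) ≡ (a′ , b′ , u′)
canonical-unique m m′ can can′
  with Fin.≤-antisym (Canonical.least-unfinished can (canonical-unfinished m′ can′))
                     (Canonical.least-unfinished can′ (canonical-unfinished m can))
... | refl = cong (_ ,_) (canonical-partner-unique m m′ can can′)

increasing-chains-unique : ∀ {n} {x y : PPVec n} {s s′ : Steps n} → MergeChain x s y → Increasing s →
                           MergeChain x s′ y → Increasing s′ → s′ ≡ s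
increasing-chains-unique ε _ ε _ = refl
increasing-chains-unique ε _ (m ◅ c) _ = ⊥-elim (nonempty-chain-≢ m c refl)
increasing-chains-unique (m ◅ c) _ ε _ = ⊥-elim (nonempty-chain-≢ m c refl)
increasing-chains-unique {s = _ ∷ s} {_ ∷ s′} (m ◅ c) inc (m′ ◅ c′) inc′
  with canonical-unique m m′ (increasing⇒canonical m c inc) (increasing⇒canonical m′ c′ inc′)
... | refl with trans (Merge.result m′) (sym (Merge.result m))
...   | refl = cong (_ ∷_) (increasing-chains-unique c (increasing-tail s inc) c′ (increasing-tail s′ inc′))

-- Existence

-- The order _≼_, described blockwise.
record _⊑_ {n} (x y : PPVec n) : Set where
  field
    pointed-x : IsPointedPartition x
    pointed-y : IsPointedPartition y
    coarser : ∀ {i j} → x ! i ≡ x ! j → y ! i ≡ y ! j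
    points-inherited : ∀ i → IsPoint x (y ! i)

≼⇒⊑ : ∀ {n} {x y : PPVec n} → IsPointedPartition x → IsPointedPartition y → x ≼ y → x ⊑ y
≼⇒⊑ {x = x} px py (s , sc) = record
  { pointed-x = px ; pointed-y = py ; coarser = chain-coarsens c
  ; points-inherited = λ i → chain-point-before c (py i) }
  where c = satChain⇒mergeChain x s sc

finished⇒≡ : ∀ {n} {x y : PPVec n} → x ⊑ y → (∀ c → ¬ Unfinished x y c) → x ≡ y
finished⇒≡ {x = x} {y} x⊑y none = lookup-ext same-point
  where
  open _⊑_ x⊑y
  same-point : ∀ i → x ! i ≡ y ! i
  same-point i with block-min x i
  ... | m , xm≡xi , m-min with x ! (y ! i) ≟ x ! m
  ...   | yes e = trans (sym xm≡xi) (trans (sym e) (points-inherited i))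
  ...   | no ne = ⊥-elim (none m (unfinished m-min (y ! i) (trans (pointed-y i) (coarser (sym xm≡xi)) , ne)))

record CanonicalStep {n} (x y : PPVec n) : Set where
  constructor step
  field
    {a b} : Fin n
    {u} : Bool
    {z} : PPVec n
    merges : Merge x z a b u
    canonical : Canonical x y a b u

module _ {n} {x y : PPVec n} (x⊑y : x ⊑ y) {a} (a-unfinished : Unfinished x y a)
         (a-least : ∀ {c} → Unfinished x y c → a ≤ᶠ c) where
  open _⊑_ x⊑y
  open Unfinished a-unfinished

  partner-above : ∀ {b} → IsBlockMin x b → y ! b ≡ y ! a → x ! a ≢ x ! b → a <ᶠ b
  partner-above b-min yb≡ya ne = Fin.≤∧≢⇒< (a-least (unfinished b-min a (sym yb≡ya , ne))) (ne ∘ cong (x !_))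

  joined-block-min : ∃[ m ] IsBlockMin x m × Joined x y a m
  joined-block-min with block-min x joiner | joined
  ... | m , xm≡xj , m-min | yj≡ya , xj≢xa = m , m-min , trans (coarser xm≡xj) yj≡ya , xj≢xa ∘ trans (sym xm≡xj)

  one-merge-step : x ! a ≡ y ! a → CanonicalStep x y
  one-merge-step xa≡ya with least (λ j → isBlockMin? x j ×-dec joined? x y a j) joined-block-min
  ... | b , (b-min , yb≡ya , xb≢xa) , b-least = step merges canonical
    where
    merges : Merge x (merge x (x ! a) (x ! b) (x ! a)) a b true
    merges = record { pointed = pointed-x ; distinct = xb≢xa ∘ sym ; a-min = is-block-min ; b-min = b-min
                    ; a<b = partner-above b-min yb≡ya (xb≢xa ∘ sym) ; result = refl }
    canonical : Canonical x y a b true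
    canonical = record { same-block = sym yb≡ya ; least-unfinished = a-least ; kept-point = xa≡ya
                       ; least-joined = λ _ _ j-min j-joined → b-least (j-min , j-joined) }

  zero-merge-step : x ! a ≢ y ! a → CanonicalStep x y
  zero-merge-step xa≢ya with block-min x (y ! a)
  ... | b , xb≡x[ya] , b-min = step merges canonical
    where
    xb≡ya : x ! b ≡ y ! a
    xb≡ya = trans xb≡x[ya] (points-inherited a)
    yb≡ya : y ! b ≡ y ! a
    yb≡ya = trans (coarser xb≡x[ya]) (pointed-y a)
    xa≢xb : x ! a ≢ x ! b
    xa≢xb xa≡xb = xa≢ya (trans xa≡xb xb≡ya)
    merges : Merge x (merge x (x ! a) (x ! b) (x ! b)) a b false
    merges = record { pointed = pointed-x ; distinct = xa≢xb ; a-min = is-block-min ; b-min = b-min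
                    ; a<b = partner-above b-min yb≡ya xa≢xb ; result = refl }
    canonical : Canonical x y a b false
    canonical = record { same-block = sym yb≡ya ; least-unfinished = a-least ; kept-point = xb≡ya
                       ; least-joined = λ () }

canonical-step : ∀ {n} {x y : PPVec n} → x ⊑ y → x ≡ y ⊎ CanonicalStep x y
canonical-step {x = x} {y} x⊑y with any? (unfinished? x y)
... | no none = inj₁ (finished⇒≡ x⊑y λ c unf → none (c , unf))
... | yes some-unfinished with least (unfinished? x y) some-unfinished
...   | a , a-unf , a-least with x ! a ≟ y ! a
...     | yes xa≡ya = inj₂ (one-merge-step x⊑y a-unf a-least xa≡ya)
...     | no xa≢ya = inj₂ (zero-merge-step x⊑y a-unf a-least xa≢ya)

canonical-step-⊑ : ∀ {n} {x y z : PPVec n} {a b u} → x ⊑ y → Merge x z a b u → Canonical x y a b u → z ⊑ y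
canonical-step-⊑ {x = x} {y} {z} {a} {b} x⊑y m can = record
  { pointed-x = pointed-after ; pointed-y = pointed-y ; coarser = coarser′ ; points-inherited = points-inherited′ }
  where
  open _⊑_ x⊑y
  open MergeProperties m
  merged⇒ya : ∀ {i} → Merged x a b i → y ! i ≡ y ! a
  merged⇒ya (inj₁ xi≡xa) = coarser xi≡xa
  merged⇒ya (inj₂ xi≡xb) = trans (coarser xi≡xb) (sym (Canonical.same-block can))
  coarser′ : ∀ {i j} → z ! i ≡ z ! j → y ! i ≡ y ! j
  coarser′ e with coarsened e
  ... | inj₁ xi≡xj = coarser xi≡xj
  ... | inj₂ (mi , mj) = trans (merged⇒ya mi) (sym (merged⇒ya mj))
  points-inherited′ : ∀ i → IsPoint z (y ! i)
  points-inherited′ i with side (y ! i)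
  ... | inside mi = trans (z-inside mi) (trans (Canonical.kept-point can) (sym (trans (sym (pointed-y i)) (merged⇒ya mi))))
  ... | outside ne₁ ne₂ = trans (z-outside ne₁ ne₂) (points-inherited i)

same-first-increase : ∀ {n} {x y z w : PPVec n} {a b b′ u u′} →
                      Merge x z a b u → Canonical x y a b u → Merge z w a b′ u′ → Canonical z y a b′ u′ →
                      (a , b , u) <Λ (a , b′ , u′)
same-first-increase {u′ = false} m can m′ can′ =
  ⊥-elim (Merge.distinct m′ (trans z-a (trans (Canonical.kept-point can) (sym (Canonical.kept-point can′)))))
  where open MergeProperties m
same-first-increase {u = false} {true} _ _ _ _ = inj₂ (refl , inj₁ (refl , refl))
same-first-increase {x = x} {a = a} {b} {b′} {true} {true} m can m′ can′ =
  inj₂ (refl , inj₂ (refl , refl , Fin.≤∧≢⇒< b≤b′ b≢b′))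
  where
  open MergeProperties m
  b′-not-merged : ¬ Merged x a b b′
  b′-not-merged mb′ = Merge.distinct m′ (trans z-a (sym (z-inside mb′)))
  b≤b′ : b ≤ᶠ b′
  b≤b′ = Canonical.least-joined can refl _ (λ j e → Merge.b-min m′ j (coarsens e))
           (sym (Canonical.same-block can′) , b′-not-merged ∘ inj₁)
  b≢b′ : b ≢ b′
  b≢b′ b≡b′ = b′-not-merged (inj₂ (cong (x !_) (sym b≡b′)))

canonical-labels-increase : ∀ {n} {x y z w : PPVec n} {a b u a′ b′ u′} →
                            Merge x z a b u → Canonical x y a b u → Merge z w a′ b′ u′ → Canonical z y a′ b′ u′ →
                            (a , b , u) <Λ (a′ , b′ , u′)
canonical-labels-increase {a = a} {a′ = a′} m can m′ can′ with a ≟ a′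
... | no a≢a′ = inj₁ (Fin.≤∧≢⇒< a≤a′ a≢a′)
  where
  a≤a′ : a ≤ᶠ a′
  a≤a′ = Canonical.least-unfinished can (unfinished-before m (canonical-unfinished m′ can′))
... | yes refl = same-first-increase m can m′ can′

HeadCanonical : ∀ {n} → PPVec n → PPVec n → Steps n → Set
HeadCanonical x y [] = ⊤
HeadCanonical x y (((a , b , u) , _) ∷ _) = Canonical x y a b u

canonical-chain-increasing : ∀ {n} {x y z : PPVec n} {a b u s} → Merge x z a b u → Canonical x y a b u →
                             MergeChain z s y → HeadCanonical z y s → Increasing s →
                             Increasing (((a , b , u) , z) ∷ s)
canonical-chain-increasing _ _ ε _ _ = tt
canonical-chain-increasing m can (m′ ◅ _) can′ inc = canonical-labels-increase m can m′ can′ , inc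

increasing-chain-exists : ∀ {n} {x y : PPVec n} → Acc _⊂_ (points x) → x ⊑ y →
                          Σ (Steps n) λ s → MergeChain x s y × Increasing s × HeadCanonical x y s
increasing-chain-exists (acc smaller) x⊑y with canonical-step x⊑y
... | inj₁ refl = [] , ε , tt , tt
... | inj₂ (step m can) with increasing-chain-exists (smaller (points-shrink m)) (canonical-step-⊑ x⊑y m can)
...   | s , c , inc , can′ = _ ∷ s , m ◅ c , canonical-chain-increasing m can c can′ inc , can

proposition2p11 : (n : ℕ) → 1 ≤ n → (x y : PPVec n) →
    IsPointedPartition x → IsPointedPartition y → x ≼ y →
    Σ _ λ steps → SatChain x steps y × Increasing steps ×
      (∀ steps' → SatChain x steps' y → Increasing steps' → steps' ≡ steps)
proposition2p11 _ _ x y px py x≼y with increasing-chain-exists (⊂-wellFounded (points x)) (≼⇒⊑ px py x≼y)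
... | s , c , inc , _ =
  s , mergeChain⇒satChain c , inc ,
  λ s′ sc′ inc′ → increasing-chains-unique c inc (satChain⇒mergeChain x s′ sc′) inc′
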